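{- The relation $\lesssim_\omega$ is a pre-congruence for CCS: for all CCS processes $Q,P$ with $Q\lesssim_\omega P$ and every CCS context $C$ (including contexts built with recursive definitions), $C[Q]\lesssim_\omega C[P]$.
   Context: CCS is Milner's Calculus of Communicating Systems with its standard labelled transition semantics (visible actions $a,\overline a$ and invisible action $\tau$). $\Rightarrow$ is the reflexive-transitive closure of $\xrightarrow{\tau}$; $\stackrel{\hat\mu}{\Rightarrow}$ is $\Rightarrow$ if $\mu=\tau$ and $\Rightarrow\xrightarrow{\mu}\Rightarrow$ otherwise. Relations $\lesssim_k$: $\lesssim_0$ is the universal relation on processes; for $1\le k<\omega$, $Q\lesssim_k P$ iff whenever $Q\xrightarrow{\mu}Q'$ there is $P'$ with $P\stackrel{\hat\mu}{\Rightarrow}P'$ and $Q'\lesssim_{k-1}P'$; $Q\lesssim_\omega P$ iff $Q\lesssim_k P$ for all $k<\omega$. -}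

module Defs where

open import Data.Nat using (ℕ)
open import Data.Fin using (Fin; zero; suc)
open import Data.Bool using (Bool; false)
open import Data.Product using (Σ; _×_)
open import Data.Unit using (⊤)
open import Relation.Binary.PropositionalEquality using (_≡_)
open import Relation.Binary.Construct.Closure.ReflexiveTransitive using (Star)

Name : Set
Name = ℕ

data Act : Set where
  τ   : Act
  inp : Name → Act
  out : Name → Act

relabel : (Name → Name) → Act → Act
relabel f τ       = τ
relabel f (inp a) = inp (f a)
relabel f (out a) = out (f a)

-- the action is allowed through a restriction by the name set L
-- (given by its characteristic function): τ, or a visible action on a name outside L
data Allowed (L : Name → Bool) : Act → Set where
  allowτ   : Allowed L τ
  allowInp : ∀ {a} → L a ≡ false → Allowed L (inp a)
  allowOut : ∀ {a} → L a ≡ false → Allowed L (out a)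

-- CCS process terms with recursion (μX.P), de Bruijn-scoped:
-- Proc n has at most n free recursion variables; processes are Proc 0.

data Proc (n : ℕ) : Set where
  𝟎    : Proc n
  var  : Fin n → Proc n
  _∙_  : Act → Proc n → Proc n
  _⊕_  : Proc n → Proc n → Proc n
  _∥_  : Proc n → Proc n → Proc n
  _∖_  : Proc n → (Name → Bool) → Proc n
  _[_] : Proc n → (Name → Name) → Proc n
  rec  : Proc (ℕ.suc n) → Proc n

infixr 9 _∙_
infixl 6 _⊕_
infixl 5 _∥_

ext : ∀ {n m} → (Fin n → Fin m) → Fin (ℕ.suc n) → Fin (ℕ.suc m)
ext ρ zero    = zero
ext ρ (suc i) = suc (ρ i)

ren : ∀ {n m} → (Fin n → Fin m) → Proc n → Proc m
ren ρ 𝟎         = 𝟎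
ren ρ (var i)   = var (ρ i)
ren ρ (α ∙ P)   = α ∙ ren ρ P
ren ρ (P ⊕ Q)   = ren ρ P ⊕ ren ρ Q
ren ρ (P ∥ Q)   = ren ρ P ∥ ren ρ Q
ren ρ (P ∖ L)   = ren ρ P ∖ L
ren ρ (P [ f ]) = ren ρ P [ f ]
ren ρ (rec P)   = rec (ren (ext ρ) P)

exts : ∀ {n m} → (Fin n → Proc m) → Fin (ℕ.suc n) → Proc (ℕ.suc m)
exts σ zero    = var zero
exts σ (suc i) = ren suc (σ i)

sub : ∀ {n m} → (Fin n → Proc m) → Proc n → Proc m
sub σ 𝟎         = 𝟎
sub σ (var i)   = σ i
sub σ (α ∙ P)   = α ∙ sub σ P
sub σ (P ⊕ Q)   = sub σ P ⊕ sub σ Q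
sub σ (P ∥ Q)   = sub σ P ∥ sub σ Q
sub σ (P ∖ L)   = sub σ P ∖ L
sub σ (P [ f ]) = sub σ P [ f ]
sub σ (rec P)   = rec (sub (exts σ) P)

_⟨_⟩ : ∀ {n} → Proc (ℕ.suc n) → Proc n → Proc n
P ⟨ Q ⟩ = sub (λ { zero → Q ; (suc i) → var i }) P

data _─_⟶_ : Proc 0 → Act → Proc 0 → Set where
  pre   : ∀ {α P} → (α ∙ P) ─ α ⟶ P
  sumL  : ∀ {α P P' Q} → P ─ α ⟶ P' → (P ⊕ Q) ─ α ⟶ P'
  sumR  : ∀ {α P Q Q'} → Q ─ α ⟶ Q' → (P ⊕ Q) ─ α ⟶ Q'
  parL  : ∀ {α P P' Q} → P ─ α ⟶ P' → (P ∥ Q) ─ α ⟶ (P' ∥ Q)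
  parR  : ∀ {α P Q Q'} → Q ─ α ⟶ Q' → (P ∥ Q) ─ α ⟶ (P ∥ Q')
  comIO : ∀ {a P P' Q Q'} → P ─ inp a ⟶ P' → Q ─ out a ⟶ Q' → (P ∥ Q) ─ τ ⟶ (P' ∥ Q')
  comOI : ∀ {a P P' Q Q'} → P ─ out a ⟶ P' → Q ─ inp a ⟶ Q' → (P ∥ Q) ─ τ ⟶ (P' ∥ Q')
  res   : ∀ {α P P' L} → Allowed L α → P ─ α ⟶ P' → (P ∖ L) ─ α ⟶ (P' ∖ L)
  rel   : ∀ {α P P' f} → P ─ α ⟶ P' → (P [ f ]) ─ relabel f α ⟶ (P' [ f ])
  unf   : ∀ {α P P'} → (P ⟨ rec P ⟩) ─ α ⟶ P' → rec P ─ α ⟶ P'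

τstep : Proc 0 → Proc 0 → Set
τstep P P' = P ─ τ ⟶ P'

_⇒_ : Proc 0 → Proc 0 → Set
_⇒_ = Star τstep

_=[_]⇒_ : Proc 0 → Act → Proc 0 → Set
P =[ τ ]⇒ P'     = P ⇒ P'
P =[ inp a ]⇒ P' = Σ (Proc 0) λ P₁ → Σ (Proc 0) λ P₂ → P ⇒ P₁ × P₁ ─ inp a ⟶ P₂ × P₂ ⇒ P'
P =[ out a ]⇒ P' = Σ (Proc 0) λ P₁ → Σ (Proc 0) λ P₂ → P ⇒ P₁ × P₁ ─ out a ⟶ P₂ × P₂ ⇒ P'

_≲[_]_ : Proc 0 → ℕ → Proc 0 → Set
Q ≲[ ℕ.zero ] P  = ⊤
Q ≲[ ℕ.suc k ] P = ∀ μ Q' → Q ─ μ ⟶ Q' → Σ (Proc 0) λ P' → P =[ μ ]⇒ P' × Q' ≲[ k ] P'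

_≲ω_ : Proc 0 → Proc 0 → Set
Q ≲ω P = ∀ k → Q ≲[ k ] P

-- CCS contexts (any number of occurrences of the hole, possibly under μ)

data Ctx (n : ℕ) : Set where
  hole  : Ctx n
  𝟎     : Ctx n
  var   : Fin n → Ctx n
  _∙_   : Act → Ctx n → Ctx n
  _⊕_   : Ctx n → Ctx n → Ctx n
  _∥_   : Ctx n → Ctx n → Ctx n
  _∖_   : Ctx n → (Name → Bool) → Ctx n
  _[_]  : Ctx n → (Name → Name) → Ctx n
  rec   : Ctx (ℕ.suc n) → Ctx n

weaken : ∀ {n} → Proc 0 → Proc n
weaken = ren (λ ())

fill : ∀ {n} → Ctx n → Proc 0 → Proc n
fill hole      Q = weaken Q
fill 𝟎         Q = 𝟎
fill (var i)   Q = var i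
fill (α ∙ C)   Q = α ∙ fill C Q
fill (C ⊕ D)   Q = fill C Q ⊕ fill D Q
fill (C ∥ D)   Q = fill C Q ∥ fill D Q
fill (C ∖ L)   Q = fill C Q ∖ L
fill (C [ f ]) Q = fill C Q [ f ]
fill (rec C)   Q = rec (fill C Q)

-- C[Q] and C[P] are related by Cong k, the congruence closure of ≲_k on open terms; being closed
-- under substitution, it survives the unfolding of μX.T. Residuals of transitions leave the syntactic
-- closure, so it is further closed (Static k) under |, ∖L, [f] and under enlargement U ⊑ V (V has
-- every transition of U), which absorbs an idle answer inside a sum or a μ. A transition of the left
-- side at level k + 1 is matched weakly, with residuals related at level k, by induction on the
-- transition derivation: the premise of unf is a smaller derivation, so recursion needs no extra work.
module Submission where

open import Defs
open import Data.Nat using (ℕ; zero; suc)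
open import Data.Fin using (Fin; zero; suc)
open import Data.Product using (Σ; _×_; _,_)
open import Data.Unit using (tt)
open import Function using (id; _∘_)
open import Relation.Binary.PropositionalEquality
  using (_≡_; _≗_; refl; sym; trans; cong; cong₂; subst; subst₂)
open import Relation.Binary.Construct.Closure.ReflexiveTransitive using (ε; _◅_; _◅◅_; gmap)

ren-id : ∀ {n} {ρ : Fin n → Fin n} → ρ ≗ id → ∀ T → ren ρ T ≡ T
ren-id h 𝟎         = refl
ren-id h (var i)   = cong var (h i)
ren-id h (α ∙ T)   = cong (α ∙_) (ren-id h T)
ren-id h (T ⊕ U)   = cong₂ _⊕_ (ren-id h T) (ren-id h U)
ren-id h (T ∥ U)   = cong₂ _∥_ (ren-id h T) (ren-id h U)
ren-id h (T ∖ L)   = cong (_∖ L) (ren-id h T)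
ren-id h (T [ f ]) = cong (_[ f ]) (ren-id h T)
ren-id {ρ = ρ} h (rec T) = cong rec (ren-id ext-id T)
  where
  ext-id : ext ρ ≗ id
  ext-id zero    = refl
  ext-id (suc i) = cong suc (h i)

sub-ren : ∀ {n m l} {σ : Fin m → Proc l} {ρ : Fin n → Fin m} {σ' : Fin n → Proc l}
  → σ ∘ ρ ≗ σ' → ∀ T → sub σ (ren ρ T) ≡ sub σ' T
sub-ren h 𝟎         = refl
sub-ren h (var i)   = h i
sub-ren h (α ∙ T)   = cong (α ∙_) (sub-ren h T)
sub-ren h (T ⊕ U)   = cong₂ _⊕_ (sub-ren h T) (sub-ren h U)
sub-ren h (T ∥ U)   = cong₂ _∥_ (sub-ren h T) (sub-ren h U)
sub-ren h (T ∖ L)   = cong (_∖ L) (sub-ren h T)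
sub-ren h (T [ f ]) = cong (_[ f ]) (sub-ren h T)
sub-ren {σ = σ} {ρ} {σ'} h (rec T) = cong rec (sub-ren exts-ext T)
  where
  exts-ext : exts σ ∘ ext ρ ≗ exts σ'
  exts-ext zero    = refl
  exts-ext (suc i) = cong (ren suc) (h i)

sub-var : ∀ {n m} {σ : Fin n → Proc m} {ρ : Fin n → Fin m}
  → σ ≗ var ∘ ρ → ∀ T → sub σ T ≡ ren ρ T
sub-var h 𝟎         = refl
sub-var h (var i)   = h i
sub-var h (α ∙ T)   = cong (α ∙_) (sub-var h T)
sub-var h (T ⊕ U)   = cong₂ _⊕_ (sub-var h T) (sub-var h U)
sub-var h (T ∥ U)   = cong₂ _∥_ (sub-var h T) (sub-var h U)
sub-var h (T ∖ L)   = cong (_∖ L) (sub-var h T)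
sub-var h (T [ f ]) = cong (_[ f ]) (sub-var h T)
sub-var {σ = σ} {ρ} h (rec T) = cong rec (sub-var exts-var T)
  where
  exts-var : exts σ ≗ var ∘ ext ρ
  exts-var zero    = refl
  exts-var (suc i) = cong (ren suc) (h i)

sub-weaken : ∀ {n m} (σ : Fin n → Proc m) (Q : Proc 0) → sub σ (weaken Q) ≡ weaken Q
sub-weaken σ Q = trans (sub-ren {σ' = λ ()} (λ ()) Q) (sub-var {ρ = λ ()} (λ ()) Q)

ren-weaken : ∀ {n m} (ρ : Fin n → Fin m) (Q : Proc 0) → ren ρ (weaken Q) ≡ weaken Q
ren-weaken ρ Q = trans (sym (sub-var {σ = var ∘ ρ} (λ _ → refl) (weaken Q))) (sub-weaken (var ∘ ρ) Q)

weaken-closed : (Q : Proc 0) → weaken Q ≡ Q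
weaken-closed = ren-id {ρ = λ ()} (λ ())

≲-lower : ∀ k {Q P} → Q ≲[ suc k ] P → Q ≲[ k ] P
≲-lower zero    _ = tt
≲-lower (suc k) h μ Q' t with h μ Q' t
... | P' , w , r = P' , w , ≲-lower k r

data Cong (k : ℕ) : ∀ {n} → Proc n → Proc n → Set where
  leaf : ∀ {n Q P} → Q ≲[ k ] P → Cong k {n} (weaken Q) (weaken P)
  𝟎    : ∀ {n} → Cong k {n} 𝟎 𝟎
  var  : ∀ {n} (i : Fin n) → Cong k (var i) (var i)
  _∙_  : ∀ {n} α {T U : Proc n} → Cong k T U → Cong k (α ∙ T) (α ∙ U)
  _⊕_  : ∀ {n} {T U T' U' : Proc n} → Cong k T U → Cong k T' U' → Cong k (T ⊕ T') (U ⊕ U')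
  _∥_  : ∀ {n} {T U T' U' : Proc n} → Cong k T U → Cong k T' U' → Cong k (T ∥ T') (U ∥ U')
  _∖_  : ∀ {n} {T U : Proc n} → Cong k T U → ∀ L → Cong k (T ∖ L) (U ∖ L)
  _[_] : ∀ {n} {T U : Proc n} → Cong k T U → ∀ f → Cong k (T [ f ]) (U [ f ])
  rec  : ∀ {n} {T U : Proc (suc n)} → Cong k T U → Cong k (rec T) (rec U)

fill-Cong : ∀ {k n} (C : Ctx n) {Q P : Proc 0} → Q ≲[ k ] P → Cong k (fill C Q) (fill C P)
fill-Cong hole      h = leaf h
fill-Cong 𝟎         h = 𝟎
fill-Cong (var i)   h = var i
fill-Cong (α ∙ C)   h = α ∙ fill-Cong C h
fill-Cong (C ⊕ D)   h = fill-Cong C h ⊕ fill-Cong D h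
fill-Cong (C ∥ D)   h = fill-Cong C h ∥ fill-Cong D h
fill-Cong (C ∖ L)   h = fill-Cong C h ∖ L
fill-Cong (C [ f ]) h = fill-Cong C h [ f ]
fill-Cong (rec C)   h = rec (fill-Cong C h)

Cong-lower : ∀ {k n} {T U : Proc n} → Cong (suc k) T U → Cong k T U
Cong-lower {k} (leaf h) = leaf (≲-lower k h)
Cong-lower 𝟎         = 𝟎
Cong-lower (var i)   = var i
Cong-lower (α ∙ c)   = α ∙ Cong-lower c
Cong-lower (c ⊕ d)   = Cong-lower c ⊕ Cong-lower d
Cong-lower (c ∥ d)   = Cong-lower c ∥ Cong-lower d
Cong-lower (c ∖ L)   = Cong-lower c ∖ L
Cong-lower (c [ f ]) = Cong-lower c [ f ]
Cong-lower (rec c)   = rec (Cong-lower c)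

Cong-ren : ∀ {k n m} (ρ : Fin n → Fin m) {T U : Proc n} → Cong k T U → Cong k (ren ρ T) (ren ρ U)
Cong-ren {k} ρ (leaf {Q = Q} {P} h) =
  subst₂ (Cong k) (sym (ren-weaken ρ Q)) (sym (ren-weaken ρ P)) (leaf h)
Cong-ren ρ 𝟎         = 𝟎
Cong-ren ρ (var i)   = var (ρ i)
Cong-ren ρ (α ∙ c)   = α ∙ Cong-ren ρ c
Cong-ren ρ (c ⊕ d)   = Cong-ren ρ c ⊕ Cong-ren ρ d
Cong-ren ρ (c ∥ d)   = Cong-ren ρ c ∥ Cong-ren ρ d
Cong-ren ρ (c ∖ L)   = Cong-ren ρ c ∖ L
Cong-ren ρ (c [ f ]) = Cong-ren ρ c [ f ]
Cong-ren ρ (rec c)   = rec (Cong-ren (ext ρ) c)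

Cong-sub : ∀ {k n m} {σ σ' : Fin n → Proc m} → (∀ i → Cong k (σ i) (σ' i))
  → {T U : Proc n} → Cong k T U → Cong k (sub σ T) (sub σ' U)
Cong-sub {k} {σ = σ} {σ'} h (leaf {Q = Q} {P} r) =
  subst₂ (Cong k) (sym (sub-weaken σ Q)) (sym (sub-weaken σ' P)) (leaf r)
Cong-sub h 𝟎         = 𝟎
Cong-sub h (var i)   = h i
Cong-sub h (α ∙ c)   = α ∙ Cong-sub h c
Cong-sub h (c ⊕ d)   = Cong-sub h c ⊕ Cong-sub h d
Cong-sub h (c ∥ d)   = Cong-sub h c ∥ Cong-sub h d
Cong-sub h (c ∖ L)   = Cong-sub h c ∖ L
Cong-sub h (c [ f ]) = Cong-sub h c [ f ]
Cong-sub {k} {σ = σ} {σ'} h (rec c) = rec (Cong-sub exts-Cong c)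
  where
  exts-Cong : ∀ i → Cong k (exts σ i) (exts σ' i)
  exts-Cong zero    = var zero
  exts-Cong (suc i) = Cong-ren suc (h i)

Cong-unfold : ∀ {k n} {T U : Proc (suc n)} {T₂ U₂ : Proc n}
  → Cong k T U → Cong k T₂ U₂ → Cong k (T ⟨ T₂ ⟩) (U ⟨ U₂ ⟩)
Cong-unfold c d = Cong-sub (λ { zero → d ; (suc i) → var i }) c

-- A uniform presentation of _=[_]⇒_: the τ case of the latter is a bare ⇒, which need not contain a step.
data Weak (U : Proc 0) : Act → Proc 0 → Set where
  idle : Weak U τ U
  move : ∀ {μ A B U'} → U ⇒ A → A ─ μ ⟶ B → B ⇒ U' → Weak U μ U'

Weak⇒=⇒ : ∀ {U μ U'} → Weak U μ U' → U =[ μ ]⇒ U'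
Weak⇒=⇒ idle                    = ε
Weak⇒=⇒ {μ = τ}     (move s t s') = s ◅◅ (t ◅ s')
Weak⇒=⇒ {μ = inp a} (move s t s') = _ , _ , s , t , s'
Weak⇒=⇒ {μ = out a} (move s t s') = _ , _ , s , t , s'

=⇒⇒Weak : ∀ {U U'} μ → U =[ μ ]⇒ U' → Weak U μ U'
=⇒⇒Weak τ       ε                    = idle
=⇒⇒Weak τ       (t ◅ s)              = move ε t s
=⇒⇒Weak (inp a) (_ , _ , s , t , s') = move s t s'
=⇒⇒Weak (out a) (_ , _ , s , t , s') = move s t s'

Weak-map : ∀ {μ U U'} (F : Proc 0 → Proc 0) (g : Act → Act) → g τ ≡ τ
  → (∀ {A B} → A ─ τ ⟶ B → F A ─ τ ⟶ F B) → (∀ {A B} → A ─ μ ⟶ B → F A ─ g μ ⟶ F B)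
  → Weak U μ U' → Weak (F U) (g μ) (F U')
Weak-map {U = U} F g gτ liftτ lift idle = subst (λ ν → Weak (F U) ν (F U)) (sym gτ) idle
Weak-map F g gτ liftτ lift (move s t s') = move (gmap F liftτ s) (lift t) (gmap F liftτ s')

Weak-parL : ∀ {U μ U' V} → Weak U μ U' → Weak (U ∥ V) μ (U' ∥ V)
Weak-parL {V = V} = Weak-map (_∥ V) id refl parL parL

Weak-parR : ∀ {U μ U' V} → Weak U μ U' → Weak (V ∥ U) μ (V ∥ U')
Weak-parR {V = V} = Weak-map (V ∥_) id refl parR parR

Weak-res : ∀ {U μ U' L} → Allowed L μ → Weak U μ U' → Weak (U ∖ L) μ (U' ∖ L)
Weak-res {L = L} al = Weak-map (_∖ L) id refl (res allowτ) (res al)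

Weak-rel : ∀ {U μ U' f} → Weak U μ U' → Weak (U [ f ]) (relabel f μ) (U' [ f ])
Weak-rel {f = f} = Weak-map (_[ f ]) (relabel f) refl rel rel

⇒-par : ∀ {U U' V V'} → U ⇒ U' → V ⇒ V' → (U ∥ V) ⇒ (U' ∥ V')
⇒-par {U' = U'} {V = V} s r = gmap (_∥ V) parL s ◅◅ gmap (U' ∥_) parR r

Weak-comIO : ∀ {a U U' V V'} → Weak U (inp a) U' → Weak V (out a) V' → Weak (U ∥ V) τ (U' ∥ V')
Weak-comIO (move s t s') (move r u r') = move (⇒-par s r) (comIO t u) (⇒-par s' r')

Weak-comOI : ∀ {a U U' V V'} → Weak U (out a) U' → Weak V (inp a) V' → Weak (U ∥ V) τ (U' ∥ V')
Weak-comOI (move s t s') (move r u r') = move (⇒-par s r) (comOI t u) (⇒-par s' r')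

_⊑_ : Proc 0 → Proc 0 → Set
U ⊑ V = ∀ {μ X} → U ─ μ ⟶ X → V ─ μ ⟶ X

data Static (k : ℕ) : Proc 0 → Proc 0 → Set where
  base : ∀ {T U} → Cong k T U → Static k T U
  up   : ∀ {T U V} → Static k T U → U ⊑ V → Static k T V
  _∥_  : ∀ {T₁ U₁ T₂ U₂} → Static k T₁ U₁ → Static k T₂ U₂ → Static k (T₁ ∥ T₂) (U₁ ∥ U₂)
  _∖_  : ∀ {T U} → Static k T U → ∀ L → Static k (T ∖ L) (U ∖ L)
  _[_] : ∀ {T U} → Static k T U → ∀ f → Static k (T [ f ]) (U [ f ])

Static-lower : ∀ {k T U} → Static (suc k) T U → Static k T U
Static-lower (base c)  = base (Cong-lower c)
Static-lower (up s h)  = up (Static-lower s) h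
Static-lower (s ∥ r)   = Static-lower s ∥ Static-lower r
Static-lower (s ∖ L)   = Static-lower s ∖ L
Static-lower (s [ f ]) = Static-lower s [ f ]

Match : ℕ → Proc 0 → Act → Proc 0 → Set
Match k U μ T' = Σ (Proc 0) λ U' → Weak U μ U' × Static k T' U'

Match-⊑ : ∀ {k U V μ T'} → U ⊑ V → Match k U μ T' → Match k V μ T'
Match-⊑ {V = V} h (_ , idle , s)              = V , idle , up s h
Match-⊑ h (_ , move ε t s' , s)          = _ , move ε (h t) s' , s
Match-⊑ h (_ , move (t₀ ◅ s₀) t s' , s) = _ , move (h t₀ ◅ s₀) t s' , s

Match-parL : ∀ {k U μ T' T₂ U₂} → Match k U μ T' → Static k T₂ U₂ → Match k (U ∥ U₂) μ (T' ∥ T₂)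
Match-parL (_ , w , s) r = _ , Weak-parL w , s ∥ r

Match-parR : ∀ {k U μ T' T₁ U₁} → Static k T₁ U₁ → Match k U μ T' → Match k (U₁ ∥ U) μ (T₁ ∥ T')
Match-parR r (_ , w , s) = _ , Weak-parR w , r ∥ s

Match-comIO : ∀ {k a U V T' R'} → Match k U (inp a) T' → Match k V (out a) R' → Match k (U ∥ V) τ (T' ∥ R')
Match-comIO (_ , w , s) (_ , v , r) = _ , Weak-comIO w v , s ∥ r

Match-comOI : ∀ {k a U V T' R'} → Match k U (out a) T' → Match k V (inp a) R' → Match k (U ∥ V) τ (T' ∥ R')
Match-comOI (_ , w , s) (_ , v , r) = _ , Weak-comOI w v , s ∥ r

Match-res : ∀ {k U μ T' L} → Allowed L μ → Match k U μ T' → Match k (U ∖ L) μ (T' ∖ L)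
Match-res {L = L} al (_ , w , s) = _ , Weak-res al w , s ∖ L

Match-rel : ∀ {k U μ T' f} → Match k U μ T' → Match k (U [ f ]) (relabel f μ) (T' [ f ])
Match-rel {f = f} (_ , w , s) = _ , Weak-rel w , s [ f ]

leaf-simulates : ∀ {k Q P μ Q'} → Q ≲[ suc k ] P → weaken Q ─ μ ⟶ Q' → Match k (weaken P) μ Q'
leaf-simulates {k} {Q} {P} {μ} {Q'} h t
  with h μ Q' (subst (λ X → X ─ μ ⟶ Q') (weaken-closed Q) t)
... | P' , w , r =
  P' , subst (λ X → Weak X μ P') (sym (weaken-closed P)) (=⇒⇒Weak μ w)
     , subst₂ (Static k) (weaken-closed Q') (weaken-closed P') (base (leaf r))

Cong-simulates : ∀ {k T U μ T'} → Cong (suc k) T U → T ─ μ ⟶ T' → Match k U μ T'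
Cong-simulates (leaf h)  t             = leaf-simulates h t
Cong-simulates (α ∙ c)   pre           = _ , move ε pre ε , base (Cong-lower c)
Cong-simulates (c ⊕ d)   (sumL t)      = Match-⊑ sumL (Cong-simulates c t)
Cong-simulates (c ⊕ d)   (sumR t)      = Match-⊑ sumR (Cong-simulates d t)
Cong-simulates (c ∥ d)   (parL t)      = Match-parL (Cong-simulates c t) (base (Cong-lower d))
Cong-simulates (c ∥ d)   (parR t)      = Match-parR (base (Cong-lower c)) (Cong-simulates d t)
Cong-simulates (c ∥ d)   (comIO t u)   = Match-comIO (Cong-simulates c t) (Cong-simulates d u)
Cong-simulates (c ∥ d)   (comOI t u)   = Match-comOI (Cong-simulates c t) (Cong-simulates d u)
Cong-simulates (c ∖ L)   (res al t)    = Match-res al (Cong-simulates c t)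
Cong-simulates (c [ f ]) (rel t)       = Match-rel (Cong-simulates c t)
Cong-simulates (rec c)   (unf t)       = Match-⊑ unf (Cong-simulates (Cong-unfold c (rec c)) t)

Static-simulates : ∀ {k T U μ T'} → Static (suc k) T U → T ─ μ ⟶ T' → Match k U μ T'
Static-simulates (base c)  t           = Cong-simulates c t
Static-simulates (up s h)  t           = Match-⊑ h (Static-simulates s t)
Static-simulates (s ∥ r)   (parL t)    = Match-parL (Static-simulates s t) (Static-lower r)
Static-simulates (s ∥ r)   (parR t)    = Match-parR (Static-lower s) (Static-simulates r t)
Static-simulates (s ∥ r)   (comIO t u) = Match-comIO (Static-simulates s t) (Static-simulates r u)
Static-simulates (s ∥ r)   (comOI t u) = Match-comOI (Static-simulates s t) (Static-simulates r u)
Static-simulates (s ∖ L)   (res al t)  = Match-res al (Static-simulates s t)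
Static-simulates (s [ f ]) (rel t)     = Match-rel (Static-simulates s t)

Static⇒≲ : ∀ k {T U} → Static k T U → T ≲[ k ] U
Static⇒≲ zero    s = tt
Static⇒≲ (suc k) s μ T' t with Static-simulates s t
... | U' , w , s' = U' , Weak⇒=⇒ w , Static⇒≲ k s'

proposition3p3 : (C : Ctx 0) (Q P : Proc 0) → Q ≲ω P → fill C Q ≲ω fill C P
proposition3p3 C Q P Q≲P k = Static⇒≲ k (base (fill-Cong C (Q≲P k)))
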